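{- Let $X$ be a $(95,40,12,20)$ strongly regular graph and let $K$ be a $4$-clique of $X$ that is not contained in any $5$-clique of $X$. For $i\in\{0,1,2,3\}$ let $X_i$ be the set of vertices of $V(X)\setminus V(K)$ having exactly $i$ neighbours in $K$, and suppose $(|X_0|,|X_1|,|X_2|,|X_3|)=(1,34,54,2)$. Then the two vertices of $X_3$ are not adjacent.
   Context: A $k$-regular graph $G$ on $v$ vertices is a $(v,k,\lambda,\mu)$ strongly regular graph if any two distinct adjacent vertices have exactly $\lambda$ common neighbours and any two distinct non-adjacent vertices have exactly $\mu$ common neighbours. -}

module Defs where

open import Data.Nat using (ℕ; zero; suc; _+_)
open import Data.Fin using (Fin; zero; suc)
open import Data.Bool using (Bool; true; false; if_then_else_; not; _∧_)
open import Data.Vec using (Vec; toList; lookup)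
open import Data.List using (List; length; filter)
open import Data.Bool.ListAction using (any)
open import Data.Product using (_×_)
open import Relation.Binary.PropositionalEquality using (_≡_; _≢_)
open import Data.Fin using (_≟_)
open import Relation.Nullary.Decidable using (⌊_⌋)

record Graph (n : ℕ) : Set where
  field
    adj     : Fin n → Fin n → Bool
    symm    : ∀ x y → adj x y ≡ adj y x
    irrefl  : ∀ x → adj x x ≡ false

open Graph public

count : {n : ℕ} → (Fin n → Bool) → ℕ
count {zero}  p = 0
count {suc n} p = (if p zero then 1 else 0) + count (λ i → p (suc i))

commonNbrs : {n : ℕ} → Graph n → Fin n → Fin n → ℕ
commonNbrs G x y = count (λ z → adj G x z ∧ adj G y z)

degree : {n : ℕ} → Graph n → Fin n → ℕ
degree G x = count (λ z → adj G x z)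

IsSRG : (v k l m : ℕ) → Graph v → Set
IsSRG v k l m G =
  (∀ x → degree G x ≡ k) ×
  (∀ x y → x ≢ y → adj G x y ≡ true → commonNbrs G x y ≡ l) ×
  (∀ x y → x ≢ y → adj G x y ≡ false → commonNbrs G x y ≡ m)

IsClique : {n : ℕ} → Graph n → {k : ℕ} → Vec (Fin n) k → Set
IsClique G K = ∀ i j → i ≢ j → (lookup K i ≢ lookup K j) × (adj G (lookup K i) (lookup K j) ≡ true)

inK : {n k : ℕ} → Vec (Fin n) k → Fin n → Bool
inK K x = any (λ y → ⌊ x ≟ y ⌋) (toList K)

nbrsInK : {n k : ℕ} → Graph n → Vec (Fin n) k → Fin n → ℕ
nbrsInK G K x = length (filter (λ y → Data.Bool._≟_ (adj G x y) true) (toList K))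

inXi : {n k : ℕ} → Graph n → Vec (Fin n) k → ℕ → Fin n → Bool
inXi G K i x = not (inK K x) ∧ ⌊ Data.Nat._≟_ (nbrsInK G K x) i ⌋

sizeXi : {n k : ℕ} → Graph n → Vec (Fin n) k → ℕ → ℕ
sizeXi G K i = count (inXi G K i)

-- Write A for the adjacency matrix, 𝟙 for the all-ones vector and e_v for the unit vectors.  For
-- weights a, u on a few vertices S and a constant c, the squared norm of w = c·𝟙 + a − A u is a
-- quadratic form in (c, a, u) whose coefficients are inner products of 𝟙, e_s and A e_s: these are
-- 95, 1, δ, 40, adjacencies inside S, and 12 or 20 between distinct A e_s.  Whenever the form
-- vanishes, A u = a + c·𝟙 holds at every vertex.
-- Let x, y ∈ X₃ be adjacent, missing K p and K q respectively.  If p = q, then C = {x, y} ∪ K ∖ {K p}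
-- is a 5-clique with A 1_C = 2·1_C + 2·𝟙, so every vertex outside C has exactly 2 neighbours in C;
-- but K p has 3.  If p ≠ q, the weights 3 on x, y, K p, K q and 4 on the other two vertices of K give
-- A u = 2u + 8·𝟙, which fails at the vertex of X₀, whose neighbours among them are at most x and y.

module Submission where

open import Defs
open import Data.Nat using (ℕ; zero; suc; _+_; _*_; _≤_; z≤n; s≤s; ∣_-_∣)
import Data.Nat as ℕ
open import Data.Nat.Properties
  using (+-*-semiring; ∣m-n∣≡0⇒m≡n; *-comm; *-identityˡ; *-identityʳ; +-identityʳ; *-zeroʳ;
         m+n≡0⇒m≡0; m+n≡0⇒n≡0; +-cancelʳ-≡; m≤n⇒m≤1+n; 1+n≰n; suc-injective; m*n≡0⇒m≡0∨n≡0)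
open import Data.Nat.Tactic.RingSolver using (solve-∀)
open import Data.Fin using (Fin; zero; suc; _≟_)
open import Data.Fin.Patterns using (0F; 1F; 2F; 3F)
open import Data.Bool using (Bool; true; false; if_then_else_; not; _∧_; _∨_)
open import Data.Bool.Properties using (∧-idem; ¬-not)
open import Data.Empty using (⊥)
open import Data.Product using (_×_; _,_; proj₁; proj₂; ∃-syntax)
open import Data.Sum using ([_,_]′)
open import Data.Vec using (Vec; lookup)
import Data.Vec as Vec
open import Data.Vec.Functional using (_∷_)
open import Function using (_∘_; id)
open import Function.Definitions using (Injective)
open import Relation.Binary.PropositionalEquality
open import Relation.Nullary using (¬_; yes; no; does; contradiction)
open import Relation.Nullary.Decidable using (dec-false)
open import Algebra.Properties.Semiring.Sum +-*-semiring
  using (sum; sum-syntax; sum-cong-≗; sum-replicate-zero; ∑-comm; ∑-distrib-+; *-distribˡ-sum; *-distribʳ-sum)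

𝟙 : Bool → ℕ
𝟙 b = if b then 1 else 0

δ : ∀ {n} → Fin n → Fin n → ℕ
δ i j = 𝟙 (does (i ≟ j))

𝟙-∧ : ∀ a b → 𝟙 a * 𝟙 b ≡ 𝟙 (a ∧ b)
𝟙-∧ true  true  = refl
𝟙-∧ true  false = refl
𝟙-∧ false b     = refl

𝟙≡0⇒≡false : ∀ {b} → 𝟙 b ≡ 0 → b ≡ false
𝟙≡0⇒≡false {false} _ = refl

δ-sym : ∀ {n} (i j : Fin n) → δ i j ≡ δ j i
δ-sym i j with i ≟ j | j ≟ i
... | yes _    | yes _    = refl
... | no _     | no _     = refl
... | yes refl | no j≢i   = contradiction refl j≢i
... | no i≢j   | yes refl = contradiction refl i≢j

count≡∑ : ∀ {n} (p : Fin n → Bool) → count p ≡ ∑[ i < n ] 𝟙 (p i)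
count≡∑ {zero}  p = refl
count≡∑ {suc n} p = cong (𝟙 (p zero) +_) (count≡∑ (p ∘ suc))

count-witness : ∀ {n k} (p : Fin n → Bool) → count p ≡ suc k → ∃[ i ] p i ≡ true
count-witness {suc n} p h with p zero in p₀
... | true  = zero , p₀
... | false = let i , pᵢ = count-witness (p ∘ suc) h in suc i , pᵢ

∑-zero : ∀ {n} {f : Fin n → ℕ} → (∀ i → f i ≡ 0) → ∑[ i < n ] f i ≡ 0
∑-zero {n} f≡0 = trans (sum-cong-≗ f≡0) (sum-replicate-zero n)

∑≡0⇒≡0 : ∀ {n} (f : Fin n → ℕ) → ∑[ i < n ] f i ≡ 0 → ∀ i → f i ≡ 0
∑≡0⇒≡0 {suc n} f h zero    = m+n≡0⇒m≡0 (f zero) h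
∑≡0⇒≡0 {suc n} f h (suc i) = ∑≡0⇒≡0 (f ∘ suc) (m+n≡0⇒n≡0 (f zero) h) i

∑-δˡ : ∀ {n} (s : Fin n) (f : Fin n → ℕ) → ∑[ v < n ] (δ s v * f v) ≡ f s
∑-δˡ {suc n} zero    f = trans (cong (f zero + 0 +_) (sum-replicate-zero n))
                               (trans (+-identityʳ _) (+-identityʳ _))
∑-δˡ {suc n} (suc s) f = ∑-δˡ s (f ∘ suc)

∑-δʳ : ∀ {n} (s : Fin n) (f : Fin n → ℕ) → ∑[ v < n ] (f v * δ v s) ≡ f s
∑-δʳ s f = trans (sum-cong-≗ λ v → trans (*-comm (f v) (δ v s)) (cong (_* f v) (δ-sym v s)))
                 (∑-δˡ s f)

∑𝟙≤n : ∀ {n} (b : Fin n → Bool) → ∑[ i < n ] 𝟙 (b i) ≤ n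
∑𝟙≤n {zero}  b = z≤n
∑𝟙≤n {suc n} b with b zero
... | true  = s≤s (∑𝟙≤n (b ∘ suc))
... | false = m≤n⇒m≤1+n (∑𝟙≤n (b ∘ suc))

∑𝟙≡n⇒all-true : ∀ {n} (b : Fin n → Bool) → ∑[ i < n ] 𝟙 (b i) ≡ n → ∀ i → b i ≡ true
∑𝟙≡n⇒all-true {suc n} b h i with b zero in b₀ | i
... | true  | zero  = b₀
... | true  | suc i = ∑𝟙≡n⇒all-true (b ∘ suc) (suc-injective h) i
... | false | _     = contradiction (subst (_≤ n) h (∑𝟙≤n (b ∘ suc))) 1+n≰n

∑𝟙≡n⇒one-false : ∀ {n} (b : Fin (suc n) → Bool) → ∑[ i < suc n ] 𝟙 (b i) ≡ n →
                 ∃[ p ] ∀ i → b i ≡ not (does (i ≟ p))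
∑𝟙≡n⇒one-false {n} b h with b zero in b₀
... | false = zero , λ { zero → b₀ ; (suc i) → ∑𝟙≡n⇒all-true (b ∘ suc) h i }
∑𝟙≡n⇒one-false {suc n} b h | true =
  let p , bₛ = ∑𝟙≡n⇒one-false (b ∘ suc) (suc-injective h)
  in suc p , λ { zero → b₀ ; (suc i) → bₛ i }

∣-∣²+2*≡²+² : ∀ m n → ∣ m - n ∣ * ∣ m - n ∣ + 2 * (m * n) ≡ m * m + n * n
∣-∣²+2*≡²+² zero    n       = +-identityʳ (n * n)
∣-∣²+2*≡²+² (suc m) zero    = cong (λ p → suc m * suc m + 2 * p) (*-zeroʳ m)
∣-∣²+2*≡²+² (suc m) (suc n) = begin
  d² + 2 * (suc m * suc n)          ≡⟨ split-off d² m n ⟩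
  d² + 2 * (m * n) + 2 * (1 + m + n) ≡⟨ cong (_+ 2 * (1 + m + n)) (∣-∣²+2*≡²+² m n) ⟩
  m * m + n * n + 2 * (1 + m + n)   ≡⟨ complete-squares m n ⟩
  suc m * suc m + suc n * suc n     ∎
  where
  open ≡-Reasoning
  d² = ∣ m - n ∣ * ∣ m - n ∣
  split-off : ∀ d m n → d + 2 * ((1 + m) * (1 + n)) ≡ d + 2 * (m * n) + 2 * (1 + m + n)
  split-off = solve-∀
  complete-squares : ∀ m n → m * m + n * n + 2 * (1 + m + n) ≡ (1 + m) * (1 + m) + (1 + n) * (1 + n)
  complete-squares = solve-∀

∑[f²+g²]≡2∑[fg]⇒f≗g : ∀ {n} (f g : Fin n → ℕ) →
  ∑[ v < n ] (f v * f v) + ∑[ v < n ] (g v * g v) ≡ 2 * ∑[ v < n ] (f v * g v) → f ≗ g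
∑[f²+g²]≡2∑[fg]⇒f≗g {n} f g h v =
  ∣m-n∣≡0⇒m≡n ([ id , id ]′ (m*n≡0⇒m≡0∨n≡0 _ (∑≡0⇒≡0 d ∑d≡0 v)))
  where
  open ≡-Reasoning
  d fg : Fin n → ℕ
  d  v = ∣ f v - g v ∣ * ∣ f v - g v ∣
  fg v = f v * g v
  ∑d≡0 : ∑[ v < n ] d v ≡ 0
  ∑d≡0 = +-cancelʳ-≡ (2 * sum fg) (sum d) 0 (begin
    sum d + 2 * sum fg                                      ≡⟨ cong (sum d +_) (*-distribˡ-sum 2 fg) ⟩
    sum d + ∑[ v < n ] (2 * fg v)                           ≡⟨ ∑-distrib-+ d (λ v → 2 * fg v) ⟨
    ∑[ v < n ] (d v + 2 * fg v)                             ≡⟨ sum-cong-≗ (λ v → ∣-∣²+2*≡²+² (f v) (g v)) ⟩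
    ∑[ v < n ] (f v * f v + g v * g v)                      ≡⟨ ∑-distrib-+ (λ v → f v * f v) (λ v → g v * g v) ⟩
    ∑[ v < n ] (f v * f v) + ∑[ v < n ] (g v * g v)         ≡⟨ h ⟩
    2 * sum fg                                              ∎)

linComb : ∀ {p n} → (Fin p → ℕ) → (Fin p → Fin n → ℕ) → Fin n → ℕ
linComb {p} a F v = ∑[ i < p ] (a i * F i v)

gram : ∀ {p q n} → (Fin p → Fin n → ℕ) → (Fin q → Fin n → ℕ) → Fin p → Fin q → ℕ
gram {n = n} F H i j = ∑[ v < n ] (F i v * H j v)

bilinear : ∀ {p q} → (Fin p → Fin q → ℕ) → (Fin p → ℕ) → (Fin q → ℕ) → ℕ
bilinear {p} {q} g a b = ∑[ i < p ] ∑[ j < q ] (a i * b j * g i j)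

∑*∑≡∑∑ : ∀ {p q} (f : Fin p → ℕ) (g : Fin q → ℕ) → sum f * sum g ≡ ∑[ i < p ] ∑[ j < q ] (f i * g j)
∑*∑≡∑∑ f g = trans (*-distribʳ-sum (sum g) f) (sum-cong-≗ λ i → *-distribˡ-sum (f i) g)

∑[linComb*linComb] : ∀ {p q n} (a : Fin p → ℕ) (F : Fin p → Fin n → ℕ) (b : Fin q → ℕ) (H : Fin q → Fin n → ℕ) →
  ∑[ v < n ] (linComb a F v * linComb b H v) ≡ bilinear (gram F H) a b
∑[linComb*linComb] {p} {q} {n} a F b H = begin
  ∑[ v < n ] (linComb a F v * linComb b H v)                   ≡⟨ sum-cong-≗ (λ v → ∑*∑≡∑∑ (λ i → a i * F i v) (λ j → b j * H j v)) ⟩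
  ∑[ v < n ] ∑[ i < p ] ∑[ j < q ] (a i * F i v * (b j * H j v)) ≡⟨ ∑-comm (λ v i → ∑[ j < q ] (a i * F i v * (b j * H j v))) ⟩
  ∑[ i < p ] ∑[ v < n ] ∑[ j < q ] (a i * F i v * (b j * H j v)) ≡⟨ sum-cong-≗ (λ i → ∑-comm (λ v j → a i * F i v * (b j * H j v))) ⟩
  ∑[ i < p ] ∑[ j < q ] ∑[ v < n ] (a i * F i v * (b j * H j v)) ≡⟨ sum-cong-≗ (λ i → sum-cong-≗ λ j → factor-out i j) ⟩
  bilinear (gram F H) a b                                       ∎
  where
  open ≡-Reasoning
  interchange : ∀ a f b h → a * f * (b * h) ≡ a * b * (f * h)
  interchange = solve-∀
  factor-out : ∀ i j → ∑[ v < n ] (a i * F i v * (b j * H j v)) ≡ a i * b j * gram F H i j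
  factor-out i j = trans (sum-cong-≗ λ v → interchange (a i) (F i v) (b j) (H j v))
                         (sym (*-distribˡ-sum (a i * b j) (λ v → F i v * H j v)))

bilinear-cong : ∀ {p q} {g g′ : Fin p → Fin q → ℕ} → (∀ i j → g i j ≡ g′ i j) →
                ∀ a b → bilinear g a b ≡ bilinear g′ a b
bilinear-cong g≡g′ a b = sum-cong-≗ λ i → sum-cong-≗ λ j → cong (a i * b j *_) (g≡g′ i j)

linComb≗-from-gram : ∀ {p q n} {a : Fin p → ℕ} {F : Fin p → Fin n → ℕ} {b : Fin q → ℕ} {H : Fin q → Fin n → ℕ}
  {gFF : Fin p → Fin p → ℕ} {gHH : Fin q → Fin q → ℕ} {gFH : Fin p → Fin q → ℕ} →
  (∀ i j → gram F F i j ≡ gFF i j) → (∀ i j → gram H H i j ≡ gHH i j) → (∀ i j → gram F H i j ≡ gFH i j) →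
  bilinear gFF a a + bilinear gHH b b ≡ 2 * bilinear gFH a b → linComb a F ≗ linComb b H
linComb≗-from-gram {a = a} {F} {b} {H} FF HH FH balanced = ∑[f²+g²]≡2∑[fg]⇒f≗g _ _ (begin
  ∑[ v < _ ] (linComb a F v * linComb a F v) + ∑[ v < _ ] (linComb b H v * linComb b H v)
    ≡⟨ cong₂ _+_ (trans (∑[linComb*linComb] a F a F) (bilinear-cong FF a a))
                 (trans (∑[linComb*linComb] b H b H) (bilinear-cong HH b b)) ⟩
  _ ≡⟨ balanced ⟩
  _ ≡⟨ cong (2 *_) (trans (∑[linComb*linComb] a F b H) (bilinear-cong FH a b)) ⟨
  2 * ∑[ v < _ ] (linComb a F v * linComb b H v) ∎)
  where open ≡-Reasoning

∑1≡n : ∀ n → ∑[ v < n ] 1 ≡ n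
∑1≡n zero    = refl
∑1≡n (suc n) = cong suc (∑1≡n n)

does-≟-injective : ∀ {s n} {S : Fin s → Fin n} → Injective _≡_ _≡_ S → ∀ i j → does (S i ≟ S j) ≡ does (i ≟ j)
does-≟-injective {S = S} S-inj i j with S i ≟ S j | i ≟ j
... | yes _     | yes _    = refl
... | no _      | no _     = refl
... | yes Si≡Sj | no i≢j   = contradiction (S-inj Si≡Sj) i≢j
... | no Si≢Sj  | yes refl = contradiction refl Si≢Sj

δ-injective : ∀ {s n} {S : Fin s → Fin n} → Injective _≡_ _≡_ S → ∀ i j → δ (S i) (S j) ≡ δ i j
δ-injective S-inj i j = cong 𝟙 (does-≟-injective S-inj i j)

module _ {n} (G : Graph n) where

  ∑-adj≡degree : ∀ x → ∑[ v < n ] 𝟙 (adj G x v) ≡ degree G x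
  ∑-adj≡degree x = sym (count≡∑ (adj G x))

  ∑-adj*adj≡commonNbrs : ∀ x y → ∑[ v < n ] (𝟙 (adj G x v) * 𝟙 (adj G y v)) ≡ commonNbrs G x y
  ∑-adj*adj≡commonNbrs x y =
    trans (sum-cong-≗ λ v → 𝟙-∧ (adj G x v) (adj G y v)) (sym (count≡∑ λ v → adj G x v ∧ adj G y v))

  commonNbrs-self : ∀ x → commonNbrs G x x ≡ degree G x
  commonNbrs-self x = trans (count≡∑ λ v → adj G x v ∧ adj G x v)
                            (trans (sum-cong-≗ λ v → cong 𝟙 (∧-idem (adj G x v))) (sym (count≡∑ (adj G x))))

  srg-commonNbrs : ∀ {k l m} → IsSRG n k l m G →
    ∀ x y → commonNbrs G x y ≡ (if does (x ≟ y) then k else if adj G x y then l else m)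
  srg-commonNbrs (regular , adjacent , nonadjacent) x y with x ≟ y
  ... | yes refl = trans (commonNbrs-self x) (regular x)
  ... | no x≢y with adj G x y in x~y
  ...   | true  = adjacent x y x≢y x~y
  ...   | false = nonadjacent x y x≢y x~y

pointGram : ∀ {s} → ℕ → Fin (suc s) → Fin (suc s) → ℕ
pointGram n zero    zero    = n
pointGram n zero    (suc j) = 1
pointGram n (suc i) zero    = 1
pointGram n (suc i) (suc j) = δ i j

crossGram : ∀ {s} → ℕ → (Fin s → Fin s → Bool) → Fin (suc s) → Fin s → ℕ
crossGram k E zero    j = k
crossGram k E (suc i) j = 𝟙 (E j i)

nbrGram : ∀ {s} → (k l m : ℕ) → (Fin s → Fin s → Bool) → Fin s → Fin s → ℕ
nbrGram k l m E i j = if does (i ≟ j) then k else if E i j then l else m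

-- For a frame S realising the adjacency pattern E in an (n,k,l,m) graph, Balanced says that
-- ‖c·𝟙 + Σ a_i e_{S i} − A Σ u_j e_{S j}‖² = 0, expanded through the Gram values above with the
-- cross term moved to the right, so that no subtraction occurs.
Balanced : ∀ {s} (n k l m : ℕ) (E : Fin s → Fin s → Bool) (c : ℕ) (a u : Fin s → ℕ) → Set
Balanced n k l m E c a u =
  bilinear (pointGram n) (c ∷ a) (c ∷ a) + bilinear (nbrGram k l m E) u u ≡ 2 * bilinear (crossGram k E) (c ∷ a) u

module Frame {n k l m} (G : Graph n) (srg : IsSRG n k l m G)
             {s} (S : Fin s → Fin n) (S-injective : Injective _≡_ _≡_ S)
             (E : Fin s → Fin s → Bool) (S-realises : ∀ i j → adj G (S i) (S j) ≡ E i j) where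

  pointCols : Fin (suc s) → Fin n → ℕ
  pointCols zero    v = 1
  pointCols (suc i) v = δ (S i) v

  nbrCols : Fin s → Fin n → ℕ
  nbrCols j v = 𝟙 (adj G (S j) v)

  gram-pointCols : ∀ i j → gram pointCols pointCols i j ≡ pointGram n i j
  gram-pointCols zero    zero    = ∑1≡n n
  gram-pointCols zero    (suc j) = trans (sum-cong-≗ λ v → *-comm 1 (δ (S j) v)) (∑-δˡ (S j) λ _ → 1)
  gram-pointCols (suc i) zero    = ∑-δˡ (S i) λ _ → 1
  gram-pointCols (suc i) (suc j) =
    trans (∑-δˡ (S i) (δ (S j))) (trans (δ-injective S-injective j i) (δ-sym j i))

  gram-cross : ∀ i j → gram pointCols nbrCols i j ≡ crossGram k E i j
  gram-cross zero    j = trans (sum-cong-≗ λ v → *-identityˡ (nbrCols j v))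
                               (trans (∑-adj≡degree G (S j)) (proj₁ srg (S j)))
  gram-cross (suc i) j = trans (∑-δˡ (S i) (nbrCols j)) (cong 𝟙 (S-realises j i))

  gram-nbrCols : ∀ i j → gram nbrCols nbrCols i j ≡ nbrGram k l m E i j
  gram-nbrCols i j = begin
    gram nbrCols nbrCols i j                                              ≡⟨ ∑-adj*adj≡commonNbrs G (S i) (S j) ⟩
    commonNbrs G (S i) (S j)                                              ≡⟨ srg-commonNbrs G srg (S i) (S j) ⟩
    (if does (S i ≟ S j) then k else if adj G (S i) (S j) then l else m)  ≡⟨ cong₂ (λ d e → if d then k else if e then l else m)
                                                                               (does-≟-injective S-injective i j) (S-realises i j) ⟩
    nbrGram k l m E i j                                                   ∎
    where open ≡-Reasoning

  balanced⇒≗ : ∀ {c a u} → Balanced n k l m E c a u → linComb (c ∷ a) pointCols ≗ linComb u nbrCols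
  balanced⇒≗ {c} {a} {u} =
    linComb≗-from-gram {a = c ∷ a} {pointCols} {u} {nbrCols} gram-pointCols gram-nbrCols gram-cross

  balanced-at-frame : ∀ {c a u} → Balanced n k l m E c a u → ∀ i → c + a i ≡ ∑[ j < s ] (u j * 𝟙 (E j i))
  balanced-at-frame {c} {a} {u} balanced i = begin
    c + a i                                          ≡⟨ cong₂ _+_ (*-identityʳ c) (∑-δʳ i a) ⟨
    c * 1 + ∑[ j < s ] (a j * δ j i)                 ≡⟨ cong (c * 1 +_) (sum-cong-≗ λ j →
                                                          cong (a j *_) (δ-injective S-injective j i)) ⟨
    linComb (c ∷ a) pointCols (S i)                  ≡⟨ balanced⇒≗ {c} {a} {u} balanced (S i) ⟩
    linComb u nbrCols (S i)                          ≡⟨ sum-cong-≗ (λ j → cong (λ e → u j * 𝟙 e) (S-realises j i)) ⟩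
    ∑[ j < s ] (u j * 𝟙 (E j i))                     ∎
    where open ≡-Reasoning

  balanced-off-frame : ∀ {c a u} → Balanced n k l m E c a u →
                       ∀ v → (∀ i → S i ≢ v) → c ≡ ∑[ j < s ] (u j * 𝟙 (adj G (S j) v))
  balanced-off-frame {c} {a} {u} balanced v v∉S = begin
    c                                   ≡⟨ trans (+-identityʳ (c * 1)) (*-identityʳ c) ⟨
    c * 1 + 0                           ≡⟨ cong (c * 1 +_) (∑-zero no-mass-at-v) ⟨
    linComb (c ∷ a) pointCols v         ≡⟨ balanced⇒≗ {c} {a} {u} balanced v ⟩
    ∑[ j < s ] (u j * 𝟙 (adj G (S j) v)) ∎
    where
    open ≡-Reasoning
    no-mass-at-v : ∀ j → a j * δ (S j) v ≡ 0
    no-mass-at-v j = trans (cong (λ d → a j * 𝟙 d) (dec-false (S j ≟ v) (v∉S j))) (*-zeroʳ (a j))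

inK≡false⇒∉ : ∀ {n t} (K : Vec (Fin n) t) {x} → inK K x ≡ false → ∀ j → lookup K j ≢ x
inK≡false⇒∉ (y Vec.∷ K) {x} h j with x ≟ y | j | h
... | yes _   | _     | ()
... | no x≢y  | zero  | _  = ≢-sym x≢y
... | no _    | suc j | h′ = inK≡false⇒∉ K h′ j

nbrsInK≡∑ : ∀ {n t} (G : Graph n) (K : Vec (Fin n) t) x → nbrsInK G K x ≡ ∑[ j < t ] 𝟙 (adj G x (lookup K j))
nbrsInK≡∑ G Vec.[]      x = refl
nbrsInK≡∑ G (y Vec.∷ K) x with adj G x y
... | true  = cong suc (nbrsInK≡∑ G K x)
... | false = nbrsInK≡∑ G K x

module _ {n t} (G : Graph n) (K : Vec (Fin n) t) where

  inXi⇒ : ∀ {i x} → inXi G K i x ≡ true → inK K x ≡ false × nbrsInK G K x ≡ i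
  inXi⇒ {i} {x} h with inK K x | ℕ._≟_ (nbrsInK G K x) i | h
  ... | false | yes eq | _  = refl , eq
  ... | false | no _   | ()
  ... | true  | _      | ()

  inXi⇒∉ : ∀ {i x} → inXi G K i x ≡ true → ∀ j → lookup K j ≢ x
  inXi⇒∉ h = inK≡false⇒∉ K (proj₁ (inXi⇒ h))

  inXi⇒∑ : ∀ {i x} → inXi G K i x ≡ true → ∑[ j < t ] 𝟙 (adj G x (lookup K j)) ≡ i
  inXi⇒∑ {x = x} h = trans (sym (nbrsInK≡∑ G K x)) (proj₂ (inXi⇒ h))

  inXi-disjoint : ∀ {i i′ x x′} → i ≢ i′ → inXi G K i x ≡ true → inXi G K i′ x′ ≡ true → x ≢ x′
  inXi-disjoint i≢i′ h h′ refl = i≢i′ (trans (sym (proj₂ (inXi⇒ h))) (proj₂ (inXi⇒ h′)))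

  X₀-misses-all : ∀ {z} → inXi G K 0 z ≡ true → ∀ j → adj G z (lookup K j) ≡ false
  X₀-misses-all {z} h j = 𝟙≡0⇒≡false (∑≡0⇒≡0 (λ j → 𝟙 (adj G z (lookup K j))) (inXi⇒∑ h) j)

Xₜ-misses-one : ∀ {n t} (G : Graph n) (K : Vec (Fin n) (suc t)) {x} →
                inXi G K t x ≡ true → ∃[ p ] ∀ j → adj G x (lookup K j) ≡ not (does (j ≟ p))
Xₜ-misses-one G K {x} h = ∑𝟙≡n⇒one-false (λ j → adj G x (lookup K j)) (inXi⇒∑ G K h)

frame : ∀ {n t} → Fin n → Fin n → Vec (Fin n) t → Fin (2 + t) → Fin n
frame x y K 0F            = x
frame x y K 1F            = y
frame x y K (suc (suc j)) = lookup K j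

missPattern : ∀ {t} → Fin t → Fin t → Fin (2 + t) → Fin (2 + t) → Bool
missPattern p q 0F            0F            = false
missPattern p q 0F            1F            = true
missPattern p q 0F            (suc (suc j)) = not (does (j ≟ p))
missPattern p q 1F            0F            = true
missPattern p q 1F            1F            = false
missPattern p q 1F            (suc (suc j)) = not (does (j ≟ q))
missPattern p q (suc (suc i)) 0F            = not (does (i ≟ p))
missPattern p q (suc (suc i)) 1F            = not (does (i ≟ q))
missPattern p q (suc (suc i)) (suc (suc j)) = not (does (i ≟ j))

module AdjacentPair {n t} (G : Graph n) (K : Vec (Fin n) t) (K-clique : IsClique G K)
  {x y : Fin n} (x≢y : x ≢ y) (x∉K : ∀ j → lookup K j ≢ x) (y∉K : ∀ j → lookup K j ≢ y)
  {p q : Fin t} (x-misses : ∀ j → adj G x (lookup K j) ≡ not (does (j ≟ p)))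
  (y-misses : ∀ j → adj G y (lookup K j) ≡ not (does (j ≟ q))) (x~y : adj G x y ≡ true) where

  frame-injective : Injective _≡_ _≡_ (frame x y K)
  frame-injective {0F}          {0F}          _ = refl
  frame-injective {0F}          {1F}          e = contradiction e x≢y
  frame-injective {0F}          {suc (suc j)} e = contradiction (sym e) (x∉K j)
  frame-injective {1F}          {0F}          e = contradiction (sym e) x≢y
  frame-injective {1F}          {1F}          _ = refl
  frame-injective {1F}          {suc (suc j)} e = contradiction (sym e) (y∉K j)
  frame-injective {suc (suc i)} {0F}          e = contradiction e (x∉K i)
  frame-injective {suc (suc i)} {1F}          e = contradiction e (y∉K i)
  frame-injective {suc (suc i)} {suc (suc j)} e with i ≟ j
  ... | yes refl = refl
  ... | no i≢j   = contradiction e (proj₁ (K-clique i j i≢j))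

  frame-realises : ∀ i j → adj G (frame x y K i) (frame x y K j) ≡ missPattern p q i j
  frame-realises 0F            0F            = irrefl G x
  frame-realises 0F            1F            = x~y
  frame-realises 0F            (suc (suc j)) = x-misses j
  frame-realises 1F            0F            = trans (symm G y x) x~y
  frame-realises 1F            1F            = irrefl G y
  frame-realises 1F            (suc (suc j)) = y-misses j
  frame-realises (suc (suc i)) 0F            = trans (symm G (lookup K i) x) (x-misses i)
  frame-realises (suc (suc i)) 1F            = trans (symm G (lookup K i) y) (y-misses i)
  frame-realises (suc (suc i)) (suc (suc j)) with i ≟ j
  ... | yes refl = irrefl G (lookup K i)
  ... | no i≢j   = proj₂ (K-clique i j i≢j)

  ∑-frame-off-K : ∀ (u : Fin (2 + t) → ℕ) z → (∀ j → adj G z (lookup K j) ≡ false) →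
    ∑[ i < 2 + t ] (u i * 𝟙 (adj G (frame x y K i) z)) ≡ u 0F * 𝟙 (adj G x z) + (u 1F * 𝟙 (adj G y z) + 0)
  ∑-frame-off-K u z z-misses = cong (λ r → u 0F * 𝟙 (adj G x z) + (u 1F * 𝟙 (adj G y z) + r))
    (∑-zero λ j → trans (cong (λ b → u (suc (suc j)) * 𝟙 b) (trans (symm G (lookup K j) z) (z-misses j)))
                        (*-zeroʳ (u (suc (suc j)))))

cliqueWeights : Fin 4 → Fin 6 → ℕ
cliqueWeights p 0F            = 1
cliqueWeights p 1F            = 1
cliqueWeights p (suc (suc j)) = if does (j ≟ p) then 0 else 1

splitWeights : Fin 4 → Fin 4 → Fin 6 → ℕ
splitWeights p q 0F            = 3
splitWeights p q 1F            = 3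
splitWeights p q (suc (suc j)) = if does (j ≟ p) ∨ does (j ≟ q) then 3 else 4

clique-balanced : ∀ p → Balanced 95 40 12 20 (missPattern p p) 2 (λ i → 2 * cliqueWeights p i) (cliqueWeights p)
clique-balanced 0F = refl
clique-balanced 1F = refl
clique-balanced 2F = refl
clique-balanced 3F = refl

split-balanced : ∀ p q → p ≢ q → Balanced 95 40 12 20 (missPattern p q) 8 (λ i → 2 * splitWeights p q i) (splitWeights p q)
split-balanced 0F 0F p≢q = contradiction refl p≢q
split-balanced 0F 1F _   = refl
split-balanced 0F 2F _   = refl
split-balanced 0F 3F _   = refl
split-balanced 1F 0F _   = refl
split-balanced 1F 1F p≢q = contradiction refl p≢q
split-balanced 1F 2F _   = refl
split-balanced 1F 3F _   = refl
split-balanced 2F 0F _   = refl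
split-balanced 2F 1F _   = refl
split-balanced 2F 2F p≢q = contradiction refl p≢q
split-balanced 2F 3F _   = refl
split-balanced 3F 0F _   = refl
split-balanced 3F 1F _   = refl
split-balanced 3F 2F _   = refl
split-balanced 3F 3F p≢q = contradiction refl p≢q

clique-unbalanced-at-missed : ∀ p →
  2 + 2 * cliqueWeights p (suc (suc p)) ≢ ∑[ j < 6 ] (cliqueWeights p j * 𝟙 (missPattern p p j (suc (suc p))))
clique-unbalanced-at-missed 0F ()
clique-unbalanced-at-missed 1F ()
clique-unbalanced-at-missed 2F ()
clique-unbalanced-at-missed 3F ()

8≢3*𝟙a+3*𝟙b : ∀ a b → 8 ≢ 3 * 𝟙 a + (3 * 𝟙 b + 0)
8≢3*𝟙a+3*𝟙b true  true  ()
8≢3*𝟙a+3*𝟙b true  false ()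
8≢3*𝟙a+3*𝟙b false true  ()
8≢3*𝟙a+3*𝟙b false false ()

module _ (G : Graph 95) (srg : IsSRG 95 40 12 20 G) (K : Vec (Fin 95) 4) (K-clique : IsClique G K)
         {x y : Fin 95} (x≢y : x ≢ y) (x∈X₃ : inXi G K 3 x ≡ true) (y∈X₃ : inXi G K 3 y ≡ true)
         (x~y : adj G x y ≡ true) where

  -- The weights below are passed explicitly: inferring them would unfold Balanced, which is very costly.
  X₃-same-missed-⊥ : ∀ {p} → (∀ j → adj G x (lookup K j) ≡ not (does (j ≟ p))) →
                     (∀ j → adj G y (lookup K j) ≡ not (does (j ≟ p))) → ⊥
  X₃-same-missed-⊥ {p} x-misses y-misses = clique-unbalanced-at-missed p balance-at-missed
    where
    open AdjacentPair G K K-clique x≢y (inXi⇒∉ G K x∈X₃) (inXi⇒∉ G K y∈X₃) x-misses y-misses x~y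
    open Frame G srg (frame x y K) frame-injective (missPattern p p) frame-realises
    balance-at-missed :
      2 + 2 * cliqueWeights p (suc (suc p)) ≡ ∑[ j < 6 ] (cliqueWeights p j * 𝟙 (missPattern p p j (suc (suc p))))
    balance-at-missed = balanced-at-frame {2} {λ i → 2 * cliqueWeights p i} {cliqueWeights p} (clique-balanced p) (suc (suc p))

  X₃-different-missed-⊥ : ∀ {p q z} → p ≢ q → (∀ j → adj G x (lookup K j) ≡ not (does (j ≟ p))) →
                          (∀ j → adj G y (lookup K j) ≡ not (does (j ≟ q))) → inXi G K 0 z ≡ true → ⊥
  X₃-different-missed-⊥ {p} {q} {z} p≢q x-misses y-misses z∈X₀ =
    8≢3*𝟙a+3*𝟙b (adj G x z) (adj G y z) (trans balance-at-z (∑-frame-off-K (splitWeights p q) z z-misses))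
    where
    open AdjacentPair G K K-clique x≢y (inXi⇒∉ G K x∈X₃) (inXi⇒∉ G K y∈X₃) x-misses y-misses x~y
    open Frame G srg (frame x y K) frame-injective (missPattern p q) frame-realises
    z-misses : ∀ j → adj G z (lookup K j) ≡ false
    z-misses = X₀-misses-all G K z∈X₀
    frame∌z : ∀ i → frame x y K i ≢ z
    frame∌z 0F            = inXi-disjoint G K (λ ()) x∈X₃ z∈X₀
    frame∌z 1F             = inXi-disjoint G K (λ ()) y∈X₃ z∈X₀
    frame∌z (suc (suc j)) = inXi⇒∉ G K z∈X₀ j
    balance-at-z : 8 ≡ ∑[ j < 6 ] (splitWeights p q j * 𝟙 (adj G (frame x y K j) z))
    balance-at-z = balanced-off-frame {8} {λ i → 2 * splitWeights p q i} {splitWeights p q} (split-balanced p q p≢q) z frame∌z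

  X₃-adjacent-⊥ : ∀ {z} → inXi G K 0 z ≡ true → ⊥
  X₃-adjacent-⊥ z∈X₀ with Xₜ-misses-one G K x∈X₃ | Xₜ-misses-one G K y∈X₃
  ... | p , x-misses | q , y-misses with p ≟ q
  ... | yes refl = X₃-same-missed-⊥ x-misses y-misses
  ... | no p≢q   = X₃-different-missed-⊥ p≢q x-misses y-misses z∈X₀

lemma3 : (G : Graph 95) → IsSRG 95 40 12 20 G →
    (K : Vec (Fin 95) 4) → IsClique G K →
    ((L : Vec (Fin 95) 5) → IsClique G L → ¬ (∀ x → inK K x ≡ true → inK L x ≡ true)) →
    sizeXi G K 0 ≡ 1 → sizeXi G K 1 ≡ 34 → sizeXi G K 2 ≡ 54 → sizeXi G K 3 ≡ 2 →
    (x y : Fin 95) → x ≢ y → inXi G K 3 x ≡ true → inXi G K 3 y ≡ true →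
    adj G x y ≡ false
lemma3 G srg K K-clique _ X₀≡1 _ _ _ x y x≢y x∈X₃ y∈X₃ =
  let z , z∈X₀ = count-witness (inXi G K 0) X₀≡1
  in ¬-not λ x~y → X₃-adjacent-⊥ G srg K K-clique x≢y x∈X₃ y∈X₃ x~y z∈X₀
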